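{- Let $T$ be a tree of order $n \geq 4$ with $\Delta(T) \geq 3$. Then $$\mathrm{hc}(T) = (n-1)(n-1-\zeta(T)) + \zeta'(T) - 2\mathcal{L}_W(T)$$ holds if there exists an ordering $x_0, x_1, \ldots, x_{n-1}$ of the vertices of $T$ such that for all $0 \leq i \leq n-2$: (a) $\mathcal{L}(x_0) + \mathcal{L}(x_{n-1}) = 1$ when $W(T) = \{w\}$, and $\mathcal{L}(x_0) + \mathcal{L}(x_{n-1}) = 0$ when $W(T) = \{w,w'\}$; (b) $x_i$ and $x_{i+1}$ are in different branches when $W(T) = \{w\}$, and in opposite branches when $W(T) = \{w,w'\}$; (c) $D(x_i,x_{i+1}) \leq n/2$. Moreover, under these conditions the mapping $h$ defined by $h(x_0) = 0$ and $h(x_{i+1}) = h(x_i) + n-1-\zeta(T) - \mathcal{L}(x_i) - \mathcal{L}(x_{i+1})$ ($0 \le i \le n-2$) is an optimal hamiltonian coloring of $T$.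
   Context: For a connected graph $G$ of order $n$, the detour distance $D(u,v)$ is the length of a longest $u$–$v$ path (in a tree it equals the ordinary distance). A hamiltonian coloring of $G$ is a map $h: V(G) \to \{0,1,2,\ldots\}$ with $D(u,v) + |h(u)-h(v)| \geq n-1$ for all distinct $u,v$; its span is $\max\{|h(u)-h(v)|\}$, $\mathrm{hc}(G)$ is the minimum span, and a hamiltonian coloring is optimal if its span equals $\mathrm{hc}(G)$. For a tree $T$ let $w_T(v) = \sum_u d(u,v)$; weight centers are the minimizers of $w_T$, and $W(T)$ is the set of them (one vertex $w$, or two adjacent vertices $w,w'$). $\zeta(T)=0$ if $|W(T)|=1$, $\zeta(T)=1$ if $|W(T)|=2$, $\zeta'(T)=1-\zeta(T)$. $\mathcal{L}(u) = \min\{D(u,x): x \in W(T)\}$, $\mathcal{L}_W(T) = \sum_u \mathcal{L}(u)$. Branch terminology: when $W(T)=\{w\}$, two distinct vertices $u,v$ are "in different branches" if $w$ lies on the $u$–$v$ path (equivalently, no component of $T-w$ contains both; $u$ or $v$ may be $w$ itself); when $W(T)=\{w,w'\}$, $u,v$ are "in opposite branches" if the $u$–$v$ path contains the edge $ww'$. -}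

module Defs where

open import Data.Nat using (ℕ; zero; suc; _+_; _*_; _∸_; _≤_; _<_; _≤?_; _⊔_; _⊓_; ∣_-_∣)
open import Data.Nat.Properties using (<-trans; n<1+n)
open import Data.Fin using (Fin; toℕ; fromℕ<)
open import Data.Fin.Properties using (all?)
open import Data.List using (List; []; _∷_; length; map; foldr; filter; allFin; _++_)
open import Data.Nat.ListAction using (sum)
open import Data.List.Relation.Unary.Unique.Propositional using (Unique)
open import Data.List.Membership.Propositional using (_∈_)
open import Data.Product using (Σ; ∃; _×_; _,_)
open import Data.Sum using (_⊎_)
open import Data.Empty using (⊥)
open import Relation.Binary.PropositionalEquality using (_≡_; _≢_)
open import Relation.Nullary using (¬_)
open import Data.Integer as ℤ using (ℤ; +_)
open import Function.Definitions using (Injective)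

record SimpleGraph (n : ℕ) : Set₁ where
  field
    Adj    : Fin n → Fin n → Set
    sym    : ∀ {u v} → Adj u v → Adj v u
    irrefl : ∀ {u} → ¬ Adj u u
open SimpleGraph public

module _ {n : ℕ} (G : SimpleGraph n) where

  data Walk : Fin n → Fin n → Set where
    [_]    : ∀ u → Walk u u
    _∷⟨_⟩_ : ∀ u {v w} → Adj G u v → Walk v w → Walk u w

vertices : ∀ {n} {G : SimpleGraph n} {u v} → Walk G u v → List (Fin n)
vertices [ u ] = u ∷ []
vertices (u ∷⟨ _ ⟩ p) = u ∷ vertices p

len : ∀ {n} {G : SimpleGraph n} {u v} → Walk G u v → ℕ
len [ u ] = 0
len (u ∷⟨ _ ⟩ p) = suc (len p)

IsPath : ∀ {n} {G : SimpleGraph n} {u v} → Walk G u v → Set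
IsPath p = Unique (vertices p)

module _ {n : ℕ} (G : SimpleGraph n) where

  Connected : Set
  Connected = ∀ u v → Σ (Walk G u v) IsPath

  Acyclic : Set
  Acyclic = ∀ u v (p : Walk G u v) → IsPath p → 2 ≤ len p → ¬ Adj G v u

  IsTree : Set
  IsTree = Connected × Acyclic

  MaxDegreeAtLeast3 : Set
  MaxDegreeAtLeast3 =
    ∃ λ v → ∃ λ a → ∃ λ b → ∃ λ c →
      Adj G v a × Adj G v b × Adj G v c × a ≢ b × a ≢ c × b ≢ c

  IsDetourDistance : (Fin n → Fin n → ℕ) → Set
  IsDetourDistance D =
    ∀ u v → (Σ (Walk G u v) λ p → IsPath p × len p ≡ D u v)
          × (∀ (p : Walk G u v) → IsPath p → len p ≤ D u v)

  OnPath : Fin n → Fin n → Fin n → Set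
  OnPath x u v = Σ (Walk G u v) λ p → IsPath p × x ∈ vertices p

  EdgeOnPath : Fin n → Fin n → Fin n → Fin n → Set
  EdgeOnPath a b u v = Σ (Walk G u v) λ p → IsPath p ×
    ((∃ λ l₁ → ∃ λ l₂ → vertices p ≡ l₁ ++ (a ∷ b ∷ l₂)) ⊎
     (∃ λ l₁ → ∃ λ l₂ → vertices p ≡ l₁ ++ (b ∷ a ∷ l₂)))

-- Weight centers etc., relative to the (detour = tree) distance D

module Weights {n : ℕ} (D : Fin n → Fin n → ℕ) where

  weight : Fin n → ℕ
  weight v = sum (map (λ u → D u v) (allFin n))

  centers : List (Fin n)
  centers = filter (λ x → all? (λ y → weight x ≤? weight y)) (allFin n)

  ζ-of : ℕ → ℕ
  ζ-of 2 = 1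
  ζ-of _ = 0

  ζ : ℕ
  ζ = ζ-of (length centers)

  ζ′ : ℕ
  ζ′ = 1 ∸ ζ

  𝓛 : Fin n → ℕ
  𝓛 u with centers
  ... | [] = 0
  ... | c ∷ cs = foldr (λ x acc → D u x ⊓ acc) (D u c) cs

  𝓛W : ℕ
  𝓛W = sum (map 𝓛 (allFin n))

module Colorings {n : ℕ} (D : Fin n → Fin n → ℕ) where

  maxList : List ℕ → ℕ
  maxList = foldr _⊔_ 0

  span : (Fin n → ℕ) → ℕ
  span h = maxList (map (λ u → maxList (map (λ v → ∣ h u - h v ∣) (allFin n))) (allFin n))

  IsHamiltonianColoring : (Fin n → ℕ) → Set
  IsHamiltonianColoring h = ∀ u v → u ≢ v → n ∸ 1 ≤ D u v + ∣ h u - h v ∣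

  IsOptimalHamiltonianColoring : (Fin n → ℕ) → Set
  IsOptimalHamiltonianColoring h =
    IsHamiltonianColoring h × (∀ h′ → IsHamiltonianColoring h′ → span h ≤ span h′)

  HcEquals : ℤ → Set
  HcEquals k = (Σ (Fin n → ℕ) λ h → IsHamiltonianColoring h × + span h ≡ k)
             × (∀ h → IsHamiltonianColoring h → k ℤ.≤ + span h)

-- orderings x₀,…,x_{n-1} (as injective maps Fin n → Fin n, i ↦ x_i)

module Ordering {n : ℕ} (x : Fin n → Fin n) where

  at : (i : ℕ) → i < n → Fin n
  at i p = x (fromℕ< p)

  pred< : ∀ {i} → suc i < n → i < n
  pred< {i} p = <-trans (n<1+n i) p

  hSeq : (ζ : ℕ) (𝓛 : Fin n → ℕ) → (i : ℕ) → i < n → ℤ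
  hSeq ζ 𝓛 zero p = + 0
  hSeq ζ 𝓛 (suc i) p =
    hSeq ζ 𝓛 i (pred< p) ℤ.+
      (((+ (n ∸ 1) ℤ.- + ζ) ℤ.- + 𝓛 (at i (pred< p))) ℤ.- + 𝓛 (at (suc i) p))

-- In a tree the detour distance is the ordinary distance d, and the weight w(v) = Σᵤ d(u,v) is
-- strictly convex along paths, so W(T) is a vertex or an edge. Measuring from W(T) gives
-- d(u,v) ≤ 𝓛(u) + 𝓛(v) + ζ, with equality when W(T) separates u from v, and 𝓛(u) + 𝓛(v) ≥ ζ′
-- for u ≠ v.
--
-- Lower bound: list the vertices by increasing colour. Consecutive colours differ by at least
-- (n-1) - d(u,v) ≥ (n-1) - ζ - 𝓛(u) - 𝓛(v); over the n-1 steps every 𝓛 is counted twice except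
-- at the two ends, whose sum is at least ζ′. Hence every span is at least (n-1)(n-1-ζ) + ζ′ - 2𝓛_W.
--
-- Upper bound: conditions (a) and (b) make the colouring h of the statement meet all these
-- estimates with equality, and (c) keeps it hamiltonian on non-consecutive pairs too.

module Submission where

open import Defs hiding (sym)

open import Data.Nat using (ℕ; zero; suc; _+_; _*_; _∸_; _≤_; _<_; z≤n; s≤s; _≤?_; _<?_; _⊓_; ∣_-_∣)
open import Data.Nat.Properties
open import Data.Nat.ListAction using (sum)
open import Data.Nat.ListAction.Properties using (sum-↭)
open import Data.Nat.Tactic.RingSolver using (solve-∀)
open import Data.Integer as ℤ using (+_)
import Data.Integer.Properties as ℤ
import Data.Integer.Tactic.RingSolver as ℤSolver
open import Data.Fin using (Fin; zero; suc; toℕ; fromℕ; fromℕ<; inject₁; punchOut) renaming (_≟_ to _≟ᶠ_)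
open import Data.Fin.Properties
  using (all?; any?; punchOut-injective; injective⇒≤; fromℕ<-cong; fromℕ<-toℕ; toℕ-fromℕ<; toℕ<n; toℕ-inject₁; toℕ-fromℕ)
open import Data.Fin.Permutation using (Permutation; permutation)
open import Data.List using (List; []; _∷_; _++_; length; map; allFin; tabulate)
open import Data.List.Properties using (∷-injective; map-tabulate; length-tabulate)
open import Data.List.Extrema.Nat using (argmin; f[argmin]≤f[xs])
open import Data.List.Membership.Propositional using (_∈_)
open import Data.List.Membership.Propositional.Properties using (∈-allFin; ∈-map⁺; ∈-filter⁺; ∈-filter⁻)
import Data.List.Membership.DecPropositional as DecMembership
open import Data.List.Relation.Unary.All as All using (All; []; _∷_)
open import Data.List.Relation.Unary.All.Properties using (¬Any⇒All¬)
open import Data.List.Relation.Unary.Any using (here; there)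
open import Data.List.Relation.Unary.AllPairs using ([]; _∷_)
open import Data.List.Relation.Unary.Linked using (Linked; _∷_)
open import Data.List.Relation.Unary.Unique.Propositional using (Unique)
import Data.List.Relation.Unary.Unique.Propositional.Properties as Unique
open import Data.List.Relation.Binary.Permutation.Propositional using (_↭_; ↭-sym; ↭⇒↭ₛ)
open import Data.List.Relation.Binary.Permutation.Propositional.Properties using (↭-length)
import Data.List.Relation.Binary.Permutation.Propositional.Properties as Perm
import Data.List.Relation.Binary.Permutation.Setoid.Properties as PermSetoid
import Data.List.Sort as Sort
open import Data.Product using (Σ; ∃-syntax; _×_; _,_; proj₁; proj₂)
open import Data.Sum using (_⊎_; inj₁; inj₂; [_,_]′)
open import Data.Empty using (⊥; ⊥-elim)
open import Function using (_∘_; _on_)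
open import Function.Definitions using (Injective)
open import Relation.Binary.Definitions using (tri<; tri≈; tri>)
open import Relation.Binary.PropositionalEquality
  using (_≡_; _≢_; refl; sym; trans; cong; cong₂; subst; subst₂; setoid; module ≡-Reasoning)
import Relation.Binary.Construct.On as On
open import Relation.Nullary using (Dec; yes; no)
open import Algebra.Properties.CommutativeSemigroup +-commutativeSemigroup using (interchange)
open import Algebra.Properties.CommutativeMonoid.Sum +-0-commutativeMonoid
  using (sum-permute; sum-cong-≗; sum-init-last) renaming (sum to ∑)

module _ {A : Set} where

  sum-map-+ : ∀ (f g : A → ℕ) xs → sum (map (λ x → f x + g x) xs) ≡ sum (map f xs) + sum (map g xs)
  sum-map-+ f g [] = refl
  sum-map-+ f g (x ∷ xs) rewrite sum-map-+ f g xs = interchange (f x) (g x) (sum (map f xs)) (sum (map g xs))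

  sum-map-mono-≤ : ∀ (f g : A → ℕ) xs → (∀ x → f x ≤ g x) → sum (map f xs) ≤ sum (map g xs)
  sum-map-mono-≤ f g [] f≤g = z≤n
  sum-map-mono-≤ f g (x ∷ xs) f≤g = +-mono-≤ (f≤g x) (sum-map-mono-≤ f g xs f≤g)

  sum-map-mono-< : ∀ (f g : A → ℕ) {xs y} → (∀ x → f x ≤ g x) → y ∈ xs → f y < g y →
                   sum (map f xs) < sum (map g xs)
  sum-map-mono-< f g {x ∷ xs} f≤g (here refl) fy<gy = +-mono-<-≤ fy<gy (sum-map-mono-≤ f g xs f≤g)
  sum-map-mono-< f g {x ∷ xs} f≤g (there y∈xs) fy<gy = +-mono-≤-< (f≤g x) (sum-map-mono-< f g f≤g y∈xs fy<gy)

module _ {n : ℕ} {G : SimpleGraph n} where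

  open DecMembership (_≟ᶠ_ {n}) using (_∈?_)

  length-vertices : ∀ {u v} (p : Walk G u v) → length (vertices p) ≡ suc (len p)
  length-vertices [ u ] = refl
  length-vertices (u ∷⟨ e ⟩ p) = cong suc (length-vertices p)

  start∈vertices : ∀ {u v} (p : Walk G u v) → u ∈ vertices p
  start∈vertices [ u ] = here refl
  start∈vertices (u ∷⟨ e ⟩ p) = here refl

  end∈vertices : ∀ {u v} (p : Walk G u v) → v ∈ vertices p
  end∈vertices [ u ] = here refl
  end∈vertices (u ∷⟨ e ⟩ p) = there (end∈vertices p)

  len≡0⇒≡ : ∀ {u v} (p : Walk G u v) → len p ≡ 0 → u ≡ v
  len≡0⇒≡ [ u ] _ = refl

  infixr 5 _++ʷ_

  _++ʷ_ : ∀ {u v w} → Walk G u v → Walk G v w → Walk G u w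
  [ u ] ++ʷ q = q
  (u ∷⟨ e ⟩ p) ++ʷ q = u ∷⟨ e ⟩ (p ++ʷ q)

  len-++ʷ : ∀ {u v w} (p : Walk G u v) (q : Walk G v w) → len (p ++ʷ q) ≡ len p + len q
  len-++ʷ [ u ] q = refl
  len-++ʷ (u ∷⟨ e ⟩ p) q = cong suc (len-++ʷ p q)

  ∈-++ʷ⁺ˡ : ∀ {u v w x} (p : Walk G u v) (q : Walk G v w) → x ∈ vertices p → x ∈ vertices (p ++ʷ q)
  ∈-++ʷ⁺ˡ [ u ] q (here refl) = start∈vertices q
  ∈-++ʷ⁺ˡ (u ∷⟨ e ⟩ p) q (here refl) = here refl
  ∈-++ʷ⁺ˡ (u ∷⟨ e ⟩ p) q (there x∈p) = there (∈-++ʷ⁺ˡ p q x∈p)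

  ∈-++ʷ⁺ʳ : ∀ {u v w x} (p : Walk G u v) {q : Walk G v w} → x ∈ vertices q → x ∈ vertices (p ++ʷ q)
  ∈-++ʷ⁺ʳ [ u ] x∈q = x∈q
  ∈-++ʷ⁺ʳ (u ∷⟨ e ⟩ p) x∈q = there (∈-++ʷ⁺ʳ p x∈q)

  ∈-++ʷ⁻ : ∀ {u v w x} (p : Walk G u v) {q : Walk G v w} → x ∈ vertices (p ++ʷ q) →
           x ∈ vertices p ⊎ x ∈ vertices q
  ∈-++ʷ⁻ [ u ] x∈q = inj₂ x∈q
  ∈-++ʷ⁻ (u ∷⟨ e ⟩ p) (here refl) = inj₁ (here refl)
  ∈-++ʷ⁻ (u ∷⟨ e ⟩ p) (there x∈pq) with ∈-++ʷ⁻ p x∈pq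
  ... | inj₁ x∈p = inj₁ (there x∈p)
  ... | inj₂ x∈q = inj₂ x∈q

  IsPath-++ʷ⁻ˡ : ∀ {u v w} (p : Walk G u v) {q : Walk G v w} → IsPath (p ++ʷ q) → IsPath p
  IsPath-++ʷ⁻ˡ [ u ] _ = [] ∷ []
  IsPath-++ʷ⁻ˡ (u ∷⟨ e ⟩ p) {q} (u∉pq ∷ pq-path) =
    All.tabulate (All.lookup u∉pq ∘ ∈-++ʷ⁺ˡ p q) ∷ IsPath-++ʷ⁻ˡ p pq-path

  IsPath-++ʷ⁻ʳ : ∀ {u v w} (p : Walk G u v) {q : Walk G v w} → IsPath (p ++ʷ q) → IsPath q
  IsPath-++ʷ⁻ʳ [ u ] q-path = q-path
  IsPath-++ʷ⁻ʳ (u ∷⟨ e ⟩ p) (_ ∷ pq-path) = IsPath-++ʷ⁻ʳ p pq-path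

  reverseʷ : ∀ {u v} → Walk G u v → Walk G v u
  reverseʷ [ u ] = [ u ]
  reverseʷ (_∷⟨_⟩_ u {v} e p) = reverseʷ p ++ʷ (v ∷⟨ SimpleGraph.sym G e ⟩ [ u ])

  len-reverseʷ : ∀ {u v} (p : Walk G u v) → len (reverseʷ p) ≡ len p
  len-reverseʷ [ u ] = refl
  len-reverseʷ (u ∷⟨ e ⟩ p) =
    trans (len-++ʷ (reverseʷ p) _) (trans (+-comm (len (reverseʷ p)) 1) (cong suc (len-reverseʷ p)))

  ∈-reverseʷ⁻ : ∀ {u v x} (p : Walk G u v) → x ∈ vertices (reverseʷ p) → x ∈ vertices p
  ∈-reverseʷ⁻ [ u ] x∈p = x∈p
  ∈-reverseʷ⁻ (u ∷⟨ e ⟩ p) x∈rp with ∈-++ʷ⁻ (reverseʷ p) x∈rp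
  ... | inj₁ x∈p = there (∈-reverseʷ⁻ p x∈p)
  ... | inj₂ (here refl) = there (start∈vertices p)
  ... | inj₂ (there (here refl)) = here refl

  splitAt : ∀ {u v x} (p : Walk G u v) → x ∈ vertices p →
            Σ (Walk G u x) λ q → Σ (Walk G x v) λ r → p ≡ q ++ʷ r
  splitAt [ u ] (here refl) = [ u ] , [ u ] , refl
  splitAt (u ∷⟨ e ⟩ p) (here refl) = [ u ] , u ∷⟨ e ⟩ p , refl
  splitAt (u ∷⟨ e ⟩ p) (there x∈p) with splitAt p x∈p
  ... | q , r , refl = u ∷⟨ e ⟩ q , r , refl

  splitAtEdge : ∀ {u v a b} (p : Walk G u v) l₁ l₂ → vertices p ≡ l₁ ++ a ∷ b ∷ l₂ →
                Σ (Walk G u a) λ q → Σ (Adj G a b) λ e → Σ (Walk G b v) λ r → p ≡ q ++ʷ (a ∷⟨ e ⟩ r)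
  splitAtEdge [ u ] [] l₂ ()
  splitAtEdge [ u ] (_ ∷ []) l₂ ()
  splitAtEdge [ u ] (_ ∷ _ ∷ _) l₂ ()
  splitAtEdge (u ∷⟨ e ⟩ [ w ]) [] l₂ refl = [ u ] , e , [ w ] , refl
  splitAtEdge (u ∷⟨ e ⟩ (w ∷⟨ f ⟩ p)) [] l₂ refl = [ u ] , e , w ∷⟨ f ⟩ p , refl
  splitAtEdge (u ∷⟨ e ⟩ p) (_ ∷ l₁) l₂ eq with ∷-injective eq
  ... | refl , eq′ with splitAtEdge p l₁ l₂ eq′
  ...   | q , f , r , refl = u ∷⟨ e ⟩ q , f , r , refl

  PathWithin : ∀ {u v} → Walk G u v → Set
  PathWithin {u} {v} p = Σ (Walk G u v) λ q →
    IsPath q × (∀ {x} → x ∈ vertices q → x ∈ vertices p) × len q ≤ len p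

  suffixWithin : ∀ {u v x} (p : Walk G u v) → IsPath p → x ∈ vertices p →
                 Σ (Walk G x v) λ s → IsPath s × (∀ {y} → y ∈ vertices s → y ∈ vertices p) × len s ≤ len p
  suffixWithin p p-path x∈p with splitAt p x∈p
  ... | r , s , refl = s , IsPath-++ʷ⁻ʳ r p-path , ∈-++ʷ⁺ʳ r ,
                       ≤-trans (m≤n+m (len s) (len r)) (≤-reflexive (sym (len-++ʷ r s)))

  shortcut : ∀ {u v} (p : Walk G u v) → PathWithin p
  shortcut [ u ] = [ u ] , [] ∷ [] , (λ x∈u → x∈u) , z≤n
  shortcut (u ∷⟨ e ⟩ p) with shortcut p
  ... | q , q-path , q⊆p , q≤p with u ∈? vertices q
  ...   | no u∉q = u ∷⟨ e ⟩ q , ¬Any⇒All¬ _ u∉q ∷ q-path ,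
                  (λ { (here refl) → here refl ; (there x∈q) → there (q⊆p x∈q) }) , s≤s q≤p
  ...   | yes u∈q with suffixWithin q q-path u∈q
  ...     | s , s-path , s⊆q , s≤q = s , s-path , there ∘ q⊆p ∘ s⊆q , m≤n⇒m≤1+n (≤-trans s≤q q≤p)

-- Trees and their distance

module _ {n : ℕ} {G : SimpleGraph n} (acyclic : Acyclic G) where

  -- Two paths leaving u through different neighbours a, b and meeting again at v close a cycle.
  no-fork : ∀ {u a b v} (e : Adj G u a) (p : Walk G a v) (f : Adj G u b) (q : Walk G b v) →
            IsPath (u ∷⟨ e ⟩ p) → IsPath (u ∷⟨ f ⟩ q) → a ≡ b
  no-fork {u} {a} {b} e p f q (u∉p ∷ _) (u∉q ∷ _) with a ≟ᶠ b | shortcut (p ++ʷ reverseʷ q)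
  ... | yes a≡b | _ = a≡b
  ... | no a≢b | P , P-path , P⊆pq , _ =
    ⊥-elim (acyclic u b (u ∷⟨ e ⟩ P) (u∉P ∷ P-path) (s≤s (n≢0⇒n>0 (a≢b ∘ len≡0⇒≡ P))) (SimpleGraph.sym G f))
    where
    u∉P : All (u ≢_) (vertices P)
    u∉P = All.tabulate λ x∈P → [ All.lookup u∉p , All.lookup u∉q ∘ ∈-reverseʷ⁻ q ]′ (∈-++ʷ⁻ p (P⊆pq x∈P))

  path-unique : ∀ {u v} (p q : Walk G u v) → IsPath p → IsPath q → vertices p ≡ vertices q
  path-unique [ u ] [ u ] _ _ = refl
  path-unique [ u ] (u ∷⟨ e ⟩ q) _ (u∉q ∷ _) = ⊥-elim (All.lookup u∉q (end∈vertices q) refl)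
  path-unique (u ∷⟨ e ⟩ p) [ u ] (u∉p ∷ _) _ = ⊥-elim (All.lookup u∉p (end∈vertices p) refl)
  path-unique (u ∷⟨ e ⟩ p) (u ∷⟨ f ⟩ q) ep-path@(_ ∷ p-path) fq-path@(_ ∷ q-path)
    with no-fork e p f q ep-path fq-path
  ... | refl = cong (u ∷_) (path-unique p q p-path q-path)

  no-triangle : ∀ {a b c} → Adj G a b → Adj G b c → Adj G c a → ⊥
  no-triangle {a} {b} {c} e f g = acyclic a c (a ∷⟨ e ⟩ (b ∷⟨ f ⟩ [ c ])) abc-path (s≤s (s≤s z≤n)) g
    where
    distinct : ∀ {x y} → Adj G x y → x ≢ y
    distinct xy refl = SimpleGraph.irrefl G xy
    abc-path : IsPath {G = G} (a ∷⟨ e ⟩ (b ∷⟨ f ⟩ [ c ]))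
    abc-path = (distinct e ∷ (λ a≡c → distinct g (sym a≡c)) ∷ []) ∷ (distinct f ∷ []) ∷ [] ∷ []

module TreeDistance {n : ℕ} {G : SimpleGraph n} (acyclic : Acyclic G)
                    {D : Fin n → Fin n → ℕ} (isD : IsDetourDistance G D) where

  longest : ∀ u v → Walk G u v
  longest u v = proj₁ (proj₁ (isD u v))

  longest-IsPath : ∀ u v → IsPath (longest u v)
  longest-IsPath u v = proj₁ (proj₂ (proj₁ (isD u v)))

  len-longest : ∀ u v → len (longest u v) ≡ D u v
  len-longest u v = proj₂ (proj₂ (proj₁ (isD u v)))

  path-len≡D : ∀ {u v} (p : Walk G u v) → IsPath p → len p ≡ D u v
  path-len≡D {u} {v} p p-path = trans (suc-injective same-length) (len-longest u v)
    where
    open ≡-Reasoning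
    same-length : suc (len p) ≡ suc (len (longest u v))
    same-length = begin
      suc (len p)                      ≡⟨ length-vertices p ⟨
      length (vertices p)              ≡⟨ cong length (path-unique acyclic p (longest u v) p-path (longest-IsPath u v)) ⟩
      length (vertices (longest u v))  ≡⟨ length-vertices (longest u v) ⟩
      suc (len (longest u v))          ∎

  D-refl : ∀ u → D u u ≡ 0
  D-refl u = sym (path-len≡D [ u ] ([] ∷ []))

  D-adj : ∀ {u v} → Adj G u v → D u v ≡ 1
  D-adj {u} {v} e = sym (path-len≡D (u ∷⟨ e ⟩ [ v ]) ((u≢v ∷ []) ∷ [] ∷ []))
    where
    u≢v : u ≢ v
    u≢v refl = SimpleGraph.irrefl G e

  D≡0⇒≡ : ∀ {u v} → D u v ≡ 0 → u ≡ v
  D≡0⇒≡ {u} {v} D≡0 = len≡0⇒≡ (longest u v) (trans (len-longest u v) D≡0)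

  D≡1⇒Adj : ∀ {u v} → D u v ≡ 1 → Adj G u v
  D≡1⇒Adj {u} {v} D≡1 with longest u v | len-longest u v
  ... | u ∷⟨ e ⟩ [ v ] | _ = e
  ... | [ u ] | len≡D = ⊥-elim (0≢1+n (trans len≡D D≡1))
  ... | u ∷⟨ e ⟩ (_ ∷⟨ _ ⟩ _) | len≡D = ⊥-elim (0≢1+n (sym (suc-injective (trans len≡D D≡1))))

  D≤len : ∀ {u v} (p : Walk G u v) → D u v ≤ len p
  D≤len p with shortcut p
  ... | q , q-path , _ , q≤p = subst (_≤ len p) (path-len≡D q q-path) q≤p

  D-sym : ∀ u v → D u v ≡ D v u
  D-sym u v = ≤-antisym (D-sym≤ v u) (D-sym≤ u v)
    where
    D-sym≤ : ∀ u v → D v u ≤ D u v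
    D-sym≤ u v = subst (D v u ≤_) (trans (len-reverseʷ (longest u v)) (len-longest u v))
                   (D≤len (reverseʷ (longest u v)))

  D-triangle : ∀ u w v → D u v ≤ D u w + D w v
  D-triangle u w v = subst (D u v ≤_)
    (trans (len-++ʷ (longest u w) (longest w v)) (cong₂ _+_ (len-longest u w) (len-longest w v)))
    (D≤len (longest u w ++ʷ longest w v))

  D-split : ∀ {u v x} (p : Walk G u v) → IsPath p → x ∈ vertices p → D u v ≡ D u x + D x v
  D-split p p-path x∈p with splitAt p x∈p
  ... | q , r , refl = begin
    D _ _          ≡⟨ path-len≡D (q ++ʷ r) p-path ⟨
    len (q ++ʷ r)  ≡⟨ len-++ʷ q r ⟩
    len q + len r  ≡⟨ cong₂ _+_ (path-len≡D q (IsPath-++ʷ⁻ˡ q p-path)) (path-len≡D r (IsPath-++ʷ⁻ʳ q p-path)) ⟩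
    D _ _ + D _ _  ∎
    where open ≡-Reasoning

  D-pos : ∀ u v → u ≢ v → 1 ≤ D u v
  D-pos u v u≢v = n≢0⇒n>0 (u≢v ∘ D≡0⇒≡)

-- Weight centres

module WeightCentres {n : ℕ} {G : SimpleGraph n} (acyclic : Acyclic G)
                     {D : Fin n → Fin n → ℕ} (isD : IsDetourDistance G D) where

  open DecMembership (_≟ᶠ_ {n}) using (_∈?_)
  open TreeDistance acyclic isD
  open Weights D

  neighbour-distance : ∀ {a b} (e : Adj G b a) x →
                       IsPath (b ∷⟨ e ⟩ longest a x) ⊎ D a x ≡ suc (D b x)
  neighbour-distance {a} {b} e x with b ∈? vertices (longest a x)
  ... | no b∉ = inj₁ (¬Any⇒All¬ _ b∉ ∷ longest-IsPath a x)
  ... | yes b∈ = inj₂ (trans (D-split (longest a x) (longest-IsPath a x) b∈)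
                             (cong (_+ D b x) (D-adj (SimpleGraph.sym G e))))

  D-cons : ∀ {a b x} (e : Adj G b a) → IsPath (b ∷⟨ e ⟩ longest a x) → D b x ≡ suc (D a x)
  D-cons {a} {b} {x} e path = trans (sym (path-len≡D (b ∷⟨ e ⟩ longest a x) path)) (cong suc (len-longest a x))

  -- At most one of a, c lies farther from x than b: otherwise the paths from b to x
  -- through a and through c would fork.
  midpoint-convex : ∀ {a b c} → Adj G b a → Adj G b c → a ≢ c → ∀ x → D b x + D b x ≤ D a x + D c x
  midpoint-convex {a} {b} {c} e f a≢c x with neighbour-distance e x | neighbour-distance f x
  ... | inj₁ ba-path | inj₁ bc-path = ⊥-elim (a≢c (no-fork acyclic e _ f _ ba-path bc-path))
  ... | inj₁ ba-path | inj₂ c-far rewrite c-far | D-cons e ba-path = ≤-reflexive (sym (+-suc (D a x) _))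
  ... | inj₂ a-far | inj₁ bc-path rewrite a-far | D-cons f bc-path = ≤-reflexive (cong suc (+-suc (D c x) _))
  ... | inj₂ a-far | inj₂ c-far rewrite a-far | c-far = +-mono-≤ (n≤1+n _) (n≤1+n _)

  weight-strictly-convex : ∀ {a b c} → Adj G b a → Adj G b c → a ≢ c → weight b + weight b < weight a + weight c
  weight-strictly-convex {a} {b} {c} e f a≢c =
    subst₂ _<_ (sum-map-+ (λ x → D x b) (λ x → D x b) (allFin n)) (sum-map-+ (λ x → D x a) (λ x → D x c) (allFin n))
      (sum-map-mono-< (λ x → D x b + D x b) (λ x → D x a + D x c) pointwise (∈-allFin b) at-b)
    where
    pointwise : ∀ x → D x b + D x b ≤ D x a + D x c
    pointwise x rewrite D-sym x a | D-sym x b | D-sym x c = midpoint-convex e f a≢c x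
    at-b : D b b + D b b < D b a + D b c
    at-b rewrite D-refl b | D-adj e | D-adj f = s≤s z≤n

  weight-rises : ∀ {u v t} → Adj G v u → Adj G v t → u ≢ t → weight u ≤ weight v → weight v < weight t
  weight-rises {u} {v} {t} e f u≢t wu≤wv = +-cancelˡ-< (weight v) (weight v) (weight t)
    (<-≤-trans (weight-strictly-convex e f u≢t) (+-monoˡ-≤ (weight t) wu≤wv))

  weight-rises-along : ∀ {u v z} (e : Adj G u v) (p : Walk G v z) → IsPath (u ∷⟨ e ⟩ p) →
                       1 ≤ len p → weight u ≤ weight v → weight v < weight z
  weight-rises-along e (v ∷⟨ f ⟩ [ t ]) (u∉p ∷ _) _ wu≤wv =
    weight-rises (SimpleGraph.sym G e) f (All.lookup u∉p (there (here refl))) wu≤wv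
  weight-rises-along e (v ∷⟨ f ⟩ (t ∷⟨ g ⟩ p)) (u∉p ∷ p-path) _ wu≤wv =
    <-trans wv<wt (weight-rises-along f (t ∷⟨ g ⟩ p) p-path (s≤s z≤n) (<⇒≤ wv<wt))
    where
    wv<wt : weight v < weight t
    wv<wt = weight-rises (SimpleGraph.sym G e) f (All.lookup u∉p (there (here refl))) wu≤wv

  IsMin : Fin n → Set
  IsMin x = ∀ y → weight x ≤ weight y

  isMin? : ∀ x → Dec (IsMin x)
  isMin? x = all? (λ y → weight x ≤? weight y)

  centre⇒IsMin : ∀ {c} → c ∈ centers → IsMin c
  centre⇒IsMin c∈ = proj₂ (∈-filter⁻ isMin? {xs = allFin n} c∈)

  centers-unique : Unique centers
  centers-unique = Unique.filter⁺ isMin? (Unique.allFin⁺ n)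

  centre-exists : Fin n → ∃[ c ] c ∈ centers
  centre-exists u = c , ∈-filter⁺ isMin? (∈-allFin c) (All.lookup (f[argmin]≤f[xs] u (allFin n)) ∘ ∈-allFin)
    where
    c : Fin n
    c = argmin weight u (allFin n)

  minima-adjacent : ∀ {a c} → IsMin a → IsMin c → a ≢ c → D a c ≡ 1
  minima-adjacent {a} {c} a-min c-min a≢c with longest a c | longest-IsPath a c | len-longest a c
  ... | [ a ] | _ | _ = ⊥-elim (a≢c refl)
  ... | a ∷⟨ e ⟩ [ c ] | _ | len≡D = sym len≡D
  ... | _∷⟨_⟩_ a {b} e (b ∷⟨ f ⟩ p) | path | _ =
    ⊥-elim (<⇒≱ (weight-rises-along e (b ∷⟨ f ⟩ p) path (s≤s z≤n) (a-min b)) (c-min b))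

  data CentreShape : Set where
    one : ∀ w → centers ≡ w ∷ [] → CentreShape
    two : ∀ w w′ → centers ≡ w ∷ w′ ∷ [] → CentreShape

  centreShape : Fin n → CentreShape
  centreShape u = shape centers refl (centre-exists u)
    where
    shape : ∀ cs → centers ≡ cs → ∃[ c ] c ∈ centers → CentreShape
    shape [] eq (c , c∈) with () ← subst (c ∈_) eq c∈
    shape (w ∷ []) eq _ = one w eq
    shape (w ∷ w′ ∷ []) eq _ = two w w′ eq
    shape (a ∷ b ∷ c ∷ cs) eq _ with subst Unique eq centers-unique
    ... | (a≢b ∷ a≢c ∷ _) ∷ (b≢c ∷ _) ∷ _ =
      ⊥-elim (no-triangle acyclic (adj a-min b-min a≢b) (adj b-min c-min b≢c) (adj c-min a-min (a≢c ∘ sym)))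
      where
      min : ∀ {x} → x ∈ a ∷ b ∷ c ∷ cs → IsMin x
      min x∈ = centre⇒IsMin (subst (_ ∈_) (sym eq) x∈)
      a-min : IsMin a
      a-min = min (here refl)
      b-min : IsMin b
      b-min = min (there (here refl))
      c-min : IsMin c
      c-min = min (there (there (here refl)))
      adj : ∀ {x y} → IsMin x → IsMin y → x ≢ y → Adj G x y
      adj x-min y-min x≢y = D≡1⇒Adj (minima-adjacent x-min y-min x≢y)

-- Distances measured from the centres

module CentreBounds {n : ℕ} {G : SimpleGraph n} (acyclic : Acyclic G)
                    {D : Fin n → Fin n → ℕ} (isD : IsDetourDistance G D) where

  open TreeDistance acyclic isD
  open WeightCentres acyclic isD
  open Weights D

  𝓛-one : ∀ {w} → centers ≡ w ∷ [] → ∀ u → 𝓛 u ≡ D u w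
  𝓛-one eq u with centers | eq
  ... | _ | refl = refl

  𝓛-two : ∀ {w w′} → centers ≡ w ∷ w′ ∷ [] → ∀ u → 𝓛 u ≡ D u w′ ⊓ D u w
  𝓛-two eq u with centers | eq
  ... | _ | refl = refl

  ζ-one : ∀ {w} → centers ≡ w ∷ [] → ζ ≡ 0
  ζ-one eq rewrite eq = refl

  ζ-two : ∀ {w w′} → centers ≡ w ∷ w′ ∷ [] → ζ ≡ 1
  ζ-two eq rewrite eq = refl

  ζ′-one : ∀ {w} → centers ≡ w ∷ [] → ζ′ ≡ 1
  ζ′-one eq rewrite eq = refl

  ζ′-two : ∀ {w w′} → centers ≡ w ∷ w′ ∷ [] → ζ′ ≡ 0
  ζ′-two eq rewrite eq = refl

  𝓛-attained : ∀ u → ∃[ c ] c ∈ centers × 𝓛 u ≡ D u c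
  𝓛-attained u with centreShape u
  ... | one w eq = w , subst (w ∈_) (sym eq) (here refl) , 𝓛-one eq u
  ... | two w w′ eq with ⊓-sel (D u w′) (D u w)
  ...   | inj₁ min≡w′ = w′ , subst (w′ ∈_) (sym eq) (there (here refl)) , trans (𝓛-two eq u) min≡w′
  ...   | inj₂ min≡w = w , subst (w ∈_) (sym eq) (here refl) , trans (𝓛-two eq u) min≡w

  centres-close : ∀ {c c′} → c ∈ centers → c′ ∈ centers → D c c′ ≤ ζ
  centres-close {c} {c′} c∈ c′∈ with centreShape c | c ≟ᶠ c′
  ... | _ | yes refl = subst (_≤ ζ) (sym (D-refl c)) z≤n
  ... | one w eq | no c≢c′ with subst (c ∈_) eq c∈ | subst (c′ ∈_) eq c′∈
  ...   | here refl | here refl = ⊥-elim (c≢c′ refl)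
  centres-close {c} {c′} c∈ c′∈ | two w w′ eq | no c≢c′ =
    ≤-reflexive (trans (minima-adjacent (centre⇒IsMin c∈) (centre⇒IsMin c′∈) c≢c′) (sym (ζ-two eq)))

  D≤𝓛+𝓛+ζ : ∀ u v → D u v ≤ 𝓛 u + 𝓛 v + ζ
  D≤𝓛+𝓛+ζ u v with 𝓛-attained u | 𝓛-attained v
  ... | c , c∈ , 𝓛u≡ | c′ , c′∈ , 𝓛v≡ = begin
    D u v                    ≤⟨ D-triangle u c v ⟩
    D u c + D c v            ≤⟨ +-monoʳ-≤ (D u c) (D-triangle c c′ v) ⟩
    D u c + (D c c′ + D c′ v) ≤⟨ +-monoʳ-≤ (D u c) (+-monoˡ-≤ (D c′ v) (centres-close c∈ c′∈)) ⟩
    D u c + (ζ + D c′ v)     ≡⟨ rearrange (D u c) ζ (D c′ v) ⟩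
    D u c + D c′ v + ζ       ≡⟨ cong₂ (λ a b → a + b + ζ) 𝓛u≡ (trans 𝓛v≡ (D-sym v c′)) ⟨
    𝓛 u + 𝓛 v + ζ            ∎
    where
    open ≤-Reasoning
    rearrange : ∀ a z b → a + (z + b) ≡ a + b + z
    rearrange = solve-∀

  ζ′≤𝓛+𝓛 : ∀ u v → u ≢ v → ζ′ ≤ 𝓛 u + 𝓛 v
  ζ′≤𝓛+𝓛 u v u≢v with centreShape u
  ... | two w w′ eq rewrite ζ′-two eq = z≤n
  ... | one w eq rewrite ζ′-one eq | 𝓛-one eq u | 𝓛-one eq v with D u w in Duw | D v w in Dvw
  ...   | suc _ | _ = s≤s z≤n
  ...   | zero | suc _ = s≤s z≤n
  ...   | zero | zero = ⊥-elim (u≢v (trans (D≡0⇒≡ Duw) (sym (D≡0⇒≡ Dvw))))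

  D≡𝓛+𝓛+ζ-one : ∀ {w u v} → centers ≡ w ∷ [] → OnPath G w u v → D u v ≡ 𝓛 u + 𝓛 v + ζ
  D≡𝓛+𝓛+ζ-one {w} {u} {v} eq (p , p-path , w∈p) rewrite 𝓛-one eq u | 𝓛-one eq v | ζ-one eq =
    trans (D-split p p-path w∈p) (trans (cong (_+_ (D u w)) (D-sym w v)) (sym (+-identityʳ _)))

  D-across-edge : ∀ {u v a b} (p : Walk G u v) → IsPath p → ∀ l₁ l₂ → vertices p ≡ l₁ ++ a ∷ b ∷ l₂ →
                  D u v ≡ (D u b ⊓ D u a) + (D v b ⊓ D v a) + 1
  D-across-edge {u} {v} {a} {b} p p-path l₁ l₂ eq with splitAtEdge p l₁ l₂ eq
  ... | q , e , r , refl = begin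
    D u v                                   ≡⟨ Duv ⟩
    len q + suc (len r)                     ≡⟨ +-suc (len q) (len r) ⟩
    suc (len q + len r)                     ≡⟨ +-comm 1 (len q + len r) ⟩
    len q + len r + 1
      ≡⟨ cong₂ (λ s t → s + t + 1) (m≥n⇒m⊓n≡n (n≤1+n (len q))) (m≤n⇒m⊓n≡m (n≤1+n (len r))) ⟨
    (suc (len q) ⊓ len q) + (len r ⊓ suc (len r)) + 1
      ≡⟨ cong₂ (λ s t → s + t + 1) (cong₂ _⊓_ (sym Dub) (sym Dua))
                                   (cong₂ _⊓_ (trans (sym Dbv) (D-sym b v)) (trans (sym Dav) (D-sym a v))) ⟩
    (D u b ⊓ D u a) + (D v b ⊓ D v a) + 1   ∎
    where
    open ≡-Reasoning
    ar-path : IsPath (a ∷⟨ e ⟩ r)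
    ar-path = IsPath-++ʷ⁻ʳ q p-path
    Dua : D u a ≡ len q
    Dua = sym (path-len≡D q (IsPath-++ʷ⁻ˡ q p-path))
    Dav : D a v ≡ suc (len r)
    Dav = sym (path-len≡D (a ∷⟨ e ⟩ r) ar-path)
    Dbv : D b v ≡ len r
    Dbv = sym (path-len≡D r (IsPath-++ʷ⁻ʳ (a ∷⟨ e ⟩ [ b ]) ar-path))
    Duv : D u v ≡ len q + suc (len r)
    Duv = trans (sym (path-len≡D (q ++ʷ (a ∷⟨ e ⟩ r)) p-path)) (len-++ʷ q (a ∷⟨ e ⟩ r))
    Dub : D u b ≡ suc (len q)
    Dub = +-cancelʳ-≡ (len r) (D u b) (suc (len q)) (begin
      D u b + len r   ≡⟨ cong (_+_ (D u b)) Dbv ⟨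
      D u b + D b v   ≡⟨ D-split (q ++ʷ (a ∷⟨ e ⟩ r)) p-path (∈-++ʷ⁺ʳ q (there (start∈vertices r))) ⟨
      D u v           ≡⟨ Duv ⟩
      len q + suc (len r) ≡⟨ +-suc (len q) (len r) ⟩
      suc (len q) + len r ∎)

  D≡𝓛+𝓛+ζ-two : ∀ {w w′ u v} → centers ≡ w ∷ w′ ∷ [] → EdgeOnPath G w w′ u v → D u v ≡ 𝓛 u + 𝓛 v + ζ
  D≡𝓛+𝓛+ζ-two {w} {w′} {u} {v} eq (p , p-path , inj₁ (l₁ , l₂ , vs≡)) rewrite 𝓛-two eq u | 𝓛-two eq v | ζ-two eq =
    D-across-edge p p-path l₁ l₂ vs≡
  D≡𝓛+𝓛+ζ-two {w} {w′} {u} {v} eq (p , p-path , inj₂ (l₁ , l₂ , vs≡)) rewrite 𝓛-two eq u | 𝓛-two eq v | ζ-two eq =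
    trans (D-across-edge p p-path l₁ l₂ vs≡) (cong₂ (λ s t → s + t + 1) (⊓-comm (D u w) (D u w′)) (⊓-comm (D v w) (D v w′)))

  D≡𝓛+𝓛+ζ : ∀ {u v} → (∀ w → centers ≡ w ∷ [] → OnPath G w u v) →
            (∀ w w′ → centers ≡ w ∷ w′ ∷ [] → EdgeOnPath G w w′ u v) → D u v ≡ 𝓛 u + 𝓛 v + ζ
  D≡𝓛+𝓛+ζ {u} via-centre via-edge with centreShape u
  ... | one w eq = D≡𝓛+𝓛+ζ-one eq (via-centre w eq)
  ... | two w w′ eq = D≡𝓛+𝓛+ζ-two eq (via-edge w w′ eq)

  𝓛+𝓛≡ζ′ : ∀ {u v} → (∀ w → centers ≡ w ∷ [] → 𝓛 u + 𝓛 v ≡ 1) →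
           (∀ w w′ → centers ≡ w ∷ w′ ∷ [] → 𝓛 u + 𝓛 v ≡ 0) → 𝓛 u + 𝓛 v ≡ ζ′
  𝓛+𝓛≡ζ′ {u} one-centre two-centres with centreShape u
  ... | one w eq = trans (one-centre w eq) (sym (ζ′-one eq))
  ... | two w w′ eq = trans (two-centres w w′ eq) (sym (ζ′-two eq))

+a-+c-+d-+e≡+b : ∀ a b c d e → a ≡ b + c + d + e → ((+ a ℤ.- + c) ℤ.- + d) ℤ.- + e ≡ + b
+a-+c-+d-+e≡+b _ b c d e refl = begin
  ((+ (b + c + d + e) ℤ.- + c) ℤ.- + d) ℤ.- + e            ≡⟨ cong (λ t → ((t ℤ.- + c) ℤ.- + d) ℤ.- + e) pos-sum ⟩
  ((((+ b ℤ.+ + c) ℤ.+ + d) ℤ.+ + e) ℤ.- + c ℤ.- + d) ℤ.- + e  ≡⟨ cancel (+ b) (+ c) (+ d) (+ e) ⟩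
  + b                                                      ∎
  where
  open ≡-Reasoning
  pos-sum : + (b + c + d + e) ≡ ((+ b ℤ.+ + c) ℤ.+ + d) ℤ.+ + e
  pos-sum = trans (ℤ.pos-+ (b + c + d) e) (cong (ℤ._+ + e) (trans (ℤ.pos-+ (b + c) d) (cong (ℤ._+ + d) (ℤ.pos-+ b c))))
  cancel : ∀ B C D E → ((((B ℤ.+ C) ℤ.+ D) ℤ.+ E) ℤ.- C ℤ.- D) ℤ.- E ≡ B
  cancel = ℤSolver.solve-∀

+a-+b≡+s : ∀ {a b s} → a ≡ s + b → + a ℤ.- + b ≡ + s
+a-+b≡+s {b = b} {s} refl = trans (cong (ℤ._- + b) (ℤ.pos-+ s b)) (cancel (+ s) (+ b))
  where
  cancel : ∀ S B → S ℤ.+ B ℤ.- B ≡ S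
  cancel = ℤSolver.solve-∀

+a-+b≤+s : ∀ {a b s} → a ≤ s + b → + a ℤ.- + b ℤ.≤ + s
+a-+b≤+s {a} {b} {s} a≤s+b = subst (+ a ℤ.- + b ℤ.≤_) (+a-+b≡+s {s + b} {b} {s} refl) (ℤ.+-monoˡ-≤ (ℤ.- + b) (ℤ.+≤+ a≤s+b))

hc-formula : ∀ N z z′ W → (+ N ℤ.* (+ N ℤ.- + z) ℤ.+ + z′) ℤ.- + 2 ℤ.* + W ≡ + (N * N + z′) ℤ.- + (N * z + (W + W))
hc-formula N z z′ W = begin
  (+ N ℤ.* (+ N ℤ.- + z) ℤ.+ + z′) ℤ.- + 2 ℤ.* + W                     ≡⟨ expand (+ N) (+ z) (+ z′) (+ W) ⟩
  (+ N ℤ.* + N ℤ.+ + z′) ℤ.- (+ N ℤ.* + z ℤ.+ (+ W ℤ.+ + W))           ≡⟨ cong₂ ℤ._-_ pos-left pos-right ⟨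
  + (N * N + z′) ℤ.- + (N * z + (W + W))                               ∎
  where
  open ≡-Reasoning
  expand : ∀ N Z Z′ W → (N ℤ.* (N ℤ.- Z) ℤ.+ Z′) ℤ.- + 2 ℤ.* W ≡ (N ℤ.* N ℤ.+ Z′) ℤ.- (N ℤ.* Z ℤ.+ (W ℤ.+ W))
  expand = ℤSolver.solve-∀
  pos-left : + (N * N + z′) ≡ + N ℤ.* + N ℤ.+ + z′
  pos-left = trans (ℤ.pos-+ (N * N) z′) (cong (ℤ._+ + z′) (ℤ.pos-* N N))
  pos-right : + (N * z + (W + W)) ≡ + N ℤ.* + z ℤ.+ (+ W ℤ.+ + W)
  pos-right = trans (ℤ.pos-+ (N * z) (W + W)) (cong₂ ℤ._+_ (ℤ.pos-* N z) (ℤ.pos-+ W W))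

module _ {n : ℕ} (D : Fin n → Fin n → ℕ) where

  open Colorings D

  ∈⇒≤maxList : ∀ {x} xs → x ∈ xs → x ≤ maxList xs
  ∈⇒≤maxList (y ∷ ys) (here refl) = m≤m⊔n y _
  ∈⇒≤maxList (y ∷ ys) (there x∈ys) = ≤-trans (∈⇒≤maxList ys x∈ys) (m≤n⊔m y _)

  maxList-map-≤ : ∀ {B : Set} (f : B → ℕ) xs {M} → (∀ a → f a ≤ M) → maxList (map f xs) ≤ M
  maxList-map-≤ f [] f≤M = z≤n
  maxList-map-≤ f (a ∷ xs) f≤M = ⊔-lub (f≤M a) (maxList-map-≤ f xs f≤M)

  ∣-∣≤span : ∀ h u v → ∣ h u - h v ∣ ≤ span h
  ∣-∣≤span h u v = ≤-trans (∈⇒≤maxList _ (∈-map⁺ (λ v → ∣ h u - h v ∣) (∈-allFin v)))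
                           (∈⇒≤maxList _ (∈-map⁺ (λ u → maxList (map (λ v → ∣ h u - h v ∣) (allFin n))) (∈-allFin u)))

  span≤ : ∀ h {M} → (∀ u → h u ≤ M) → span h ≤ M
  span≤ h h≤M = maxList-map-≤ _ (allFin n) λ u → maxList-map-≤ _ (allFin n) λ v →
    ≤-trans (∣m-n∣≤m⊔n (h u) (h v)) (⊔-lub (h≤M u) (h≤M v))

  hc-from-bounds : ∀ {h A C} → IsHamiltonianColoring h → A ≡ span h + C →
                   (∀ h′ → IsHamiltonianColoring h′ → A ≤ span h′ + C) →
                   HcEquals (+ A ℤ.- + C) × IsOptimalHamiltonianColoring h
  hc-from-bounds {h} {A} {C} h-ham A≡ A≤ =
    ((h , h-ham , sym (+a-+b≡+s A≡)) , λ h′ h′-ham → +a-+b≤+s (A≤ h′ h′-ham)) ,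
    h-ham , λ h′ h′-ham → +-cancelʳ-≤ C (span h) (span h′) (subst (_≤ span h′ + C) A≡ (A≤ h′ h′-ham))

-- The lower bound

module _ {A : Set} where

  stepSum : (A → A → ℕ) → A → List A → ℕ
  stepSum f v [] = 0
  stepSum f v (b ∷ l) = f v b + stepSum f b l

  final : A → List A → A
  final v [] = v
  final v (b ∷ l) = final b l

  final∈ : ∀ v b l → final b l ∈ b ∷ l
  final∈ v b [] = here refl
  final∈ v b (c ∷ l) = there (final∈ b c l)

  stepSum-mono-≤ : ∀ (f g : A → A → ℕ) v l → (∀ a b → f a b ≤ g a b) → stepSum f v l ≤ stepSum g v l
  stepSum-mono-≤ f g v [] f≤g = z≤n
  stepSum-mono-≤ f g v (b ∷ l) f≤g = +-mono-≤ (f≤g v b) (stepSum-mono-≤ f g b l f≤g)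

  stepSum-+ : ∀ (f g : A → A → ℕ) v l → stepSum (λ a b → f a b + g a b) v l ≡ stepSum f v l + stepSum g v l
  stepSum-+ f g v [] = refl
  stepSum-+ f g v (b ∷ l) rewrite stepSum-+ f g b l = interchange (f v b) (g v b) (stepSum f b l) (stepSum g b l)

  stepSum-const : ∀ c v l → stepSum (λ _ _ → c) v l ≡ length l * c
  stepSum-const c v [] = refl
  stepSum-const c v (b ∷ l) = cong (_+_ c) (stepSum-const c b l)

  -- Every vertex is counted twice: once on each of its two steps, or once as an end.
  stepSum-ends : ∀ (L : A → ℕ) v l →
                 stepSum (λ a b → L a + L b) v l + L v + L (final v l) ≡ sum (map L (v ∷ l)) + sum (map L (v ∷ l))
  stepSum-ends L v [] = cong₂ _+_ (sym (+-identityʳ (L v))) (sym (+-identityʳ (L v)))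
  stepSum-ends L v (b ∷ l) = begin
    L v + L b + P + L v + L z        ≡⟨ ar₁ (L v) (L b) P (L z) ⟩
    L v + L v + (P + L b + L z)      ≡⟨ cong (_+_ (L v + L v)) (stepSum-ends L b l) ⟩
    L v + L v + (S + S)              ≡⟨ ar₂ (L v) S ⟩
    (L v + S) + (L v + S)            ∎
    where
    open ≡-Reasoning
    P S : ℕ
    P = stepSum (λ a b → L a + L b) b l
    S = sum (map L (b ∷ l))
    z : A
    z = final b l
    ar₁ : ∀ a b p z → a + b + p + a + z ≡ a + a + (p + b + z)
    ar₁ = solve-∀
    ar₂ : ∀ a s → a + a + (s + s) ≡ (a + s) + (a + s)
    ar₂ = solve-∀

module LowerBound {n : ℕ} (D : Fin n → Fin n → ℕ) (L : Fin n → ℕ) (ζ ζ′ : ℕ)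
                  (D≤L+L+ζ : ∀ u v → D u v ≤ L u + L v + ζ)
                  (ζ′≤L+L : ∀ u v → u ≢ v → ζ′ ≤ L u + L v) where

  open Colorings D

  slack : Fin n → Fin n → ℕ
  slack u v = n ∸ 1 ∸ D u v

  slack-bound : ∀ u v → n ∸ 1 ≤ slack u v + ζ + (L u + L v)
  slack-bound u v = begin
    n ∸ 1                        ≤⟨ m≤n+m∸n (n ∸ 1) (D u v) ⟩
    D u v + slack u v            ≤⟨ +-monoˡ-≤ (slack u v) (D≤L+L+ζ u v) ⟩
    L u + L v + ζ + slack u v    ≡⟨ rearrange (L u + L v) ζ (slack u v) ⟩
    slack u v + ζ + (L u + L v)  ∎
    where
    open ≤-Reasoning
    rearrange : ∀ l z s → l + z + s ≡ s + z + l
    rearrange = solve-∀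

  rises-by-slack : ∀ h → IsHamiltonianColoring h → ∀ v l → Unique (v ∷ l) → Linked (_≤_ on h) (v ∷ l) →
                   h v + stepSum slack v l ≤ h (final v l)
  rises-by-slack h ham v [] _ _ = ≤-reflexive (+-identityʳ (h v))
  rises-by-slack h ham v (b ∷ l) (v∉l ∷ unique) (hv≤hb ∷ sorted) = begin
    h v + (slack v b + stepSum slack b l)  ≡⟨ +-assoc (h v) (slack v b) _ ⟨
    h v + slack v b + stepSum slack b l    ≤⟨ +-monoˡ-≤ (stepSum slack b l) step ⟩
    h b + stepSum slack b l                ≤⟨ rises-by-slack h ham b l unique sorted ⟩
    h (final b l)                          ∎
    where
    open ≤-Reasoning
    gap-covers : n ∸ 1 ≤ D v b + (h b ∸ h v)
    gap-covers = subst (λ t → n ∸ 1 ≤ D v b + t) (trans (∣-∣-comm (h v) (h b)) (m≤n⇒∣n-m∣≡n∸m hv≤hb))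
                       (ham v b (All.head v∉l))
    step : h v + slack v b ≤ h b
    step = ≤-trans (+-monoʳ-≤ (h v) (m≤n+o⇒m∸n≤o (n ∸ 1) (D v b) gap-covers)) (≤-reflexive (m+[n∸m]≡n hv≤hb))

  span-bound-along : ∀ h → IsHamiltonianColoring h → ∀ v b l → Unique (v ∷ b ∷ l) → Linked (_≤_ on h) (v ∷ b ∷ l) →
                     length (b ∷ l) * (n ∸ 1) + ζ′ ≤
                     span h + (length (b ∷ l) * ζ + (sum (map L (v ∷ b ∷ l)) + sum (map L (v ∷ b ∷ l))))
  span-bound-along h ham v b l unique@(v∉bl ∷ _) sorted = begin
    m * N + ζ′                            ≤⟨ +-mono-≤ steps (ζ′≤L+L v z (All.lookup v∉bl (final∈ v b l))) ⟩
    (Σslack + m * ζ + PL) + (L v + L z)   ≡⟨ rearrange Σslack (m * ζ) PL (L v) (L z) ⟩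
    Σslack + m * ζ + (PL + L v + L z)     ≡⟨ cong (_+_ (Σslack + m * ζ)) (stepSum-ends L v (b ∷ l)) ⟩
    Σslack + m * ζ + (S + S)              ≤⟨ +-monoˡ-≤ (S + S) (+-monoˡ-≤ (m * ζ) slack≤span) ⟩
    span h + m * ζ + (S + S)              ≡⟨ +-assoc (span h) (m * ζ) (S + S) ⟩
    span h + (m * ζ + (S + S))            ∎
    where
    open ≤-Reasoning
    N m S Σslack PL : ℕ
    N = n ∸ 1
    m = length (b ∷ l)
    S = sum (map L (v ∷ b ∷ l))
    Σslack = stepSum slack v (b ∷ l)
    PL = stepSum (λ a c → L a + L c) v (b ∷ l)
    z : Fin n
    z = final b l
    rearrange : ∀ s c p x y → (s + c + p) + (x + y) ≡ s + c + (p + x + y)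
    rearrange = solve-∀
    steps : m * N ≤ Σslack + m * ζ + PL
    steps = begin
      m * N                                                     ≡⟨ stepSum-const N v (b ∷ l) ⟨
      stepSum (λ _ _ → N) v (b ∷ l)                             ≤⟨ stepSum-mono-≤ _ _ v (b ∷ l) slack-bound ⟩
      stepSum (λ a c → slack a c + ζ + (L a + L c)) v (b ∷ l)
        ≡⟨ stepSum-+ (λ a c → slack a c + ζ) (λ a c → L a + L c) v (b ∷ l) ⟩
      stepSum (λ a c → slack a c + ζ) v (b ∷ l) + PL
        ≡⟨ cong (_+ PL) (stepSum-+ slack (λ _ _ → ζ) v (b ∷ l)) ⟩
      Σslack + stepSum (λ _ _ → ζ) v (b ∷ l) + PL
        ≡⟨ cong (λ t → Σslack + t + PL) (stepSum-const ζ v (b ∷ l)) ⟩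
      Σslack + m * ζ + PL                                       ∎
    climb : h v + Σslack ≤ h z
    climb = rises-by-slack h ham v (b ∷ l) unique sorted
    slack≤span : Σslack ≤ span h
    slack≤span = begin
      Σslack           ≤⟨ m+n≤o⇒m≤o∸n Σslack (subst (_≤ h z) (+-comm (h v) Σslack) climb) ⟩
      h z ∸ h v        ≡⟨ m≤n⇒∣n-m∣≡n∸m (m+n≤o⇒m≤o (h v) climb) ⟨
      ∣ h z - h v ∣    ≤⟨ ∣-∣≤span D h z v ⟩
      span h           ∎

  span-lower-bound : 2 ≤ n → ∀ h → IsHamiltonianColoring h →
                     (n ∸ 1) * (n ∸ 1) + ζ′ ≤ span h + ((n ∸ 1) * ζ + (sum (map L (allFin n)) + sum (map L (allFin n))))
  span-lower-bound 2≤n h ham = along (sort (allFin n)) (sort-↭ (allFin n)) (sort-↗ (allFin n))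
    where
    open Sort (On.decTotalOrder ≤-decTotalOrder h) using (sort; sort-↭; sort-↗)
    length-allFin : length (allFin n) ≡ n
    length-allFin = length-tabulate (λ i → i)
    along : ∀ s → s ↭ allFin n → Linked (_≤_ on h) s →
            (n ∸ 1) * (n ∸ 1) + ζ′ ≤ span h + ((n ∸ 1) * ζ + (sum (map L (allFin n)) + sum (map L (allFin n))))
    along [] s↭ _ with () ← subst (2 ≤_) (sym (trans (↭-length s↭) length-allFin)) 2≤n
    along (v ∷ []) s↭ _ with s≤s () ← subst (2 ≤_) (sym (trans (↭-length s↭) length-allFin)) 2≤n
    along (v ∷ b ∷ l) s↭ sorted =
      subst₂ (λ m S → m * (n ∸ 1) + ζ′ ≤ span h + (m * ζ + (S + S)))
             (cong (_∸ 1) (trans (↭-length s↭) length-allFin))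
             (sum-↭ (Perm.map⁺ L s↭))
             (span-bound-along h ham v b l unique sorted)
      where
      unique : Unique (v ∷ b ∷ l)
      unique = PermSetoid.Unique-resp-↭ (setoid (Fin n))
                 (↭⇒↭ₛ (↭-sym s↭)) (Unique.allFin⁺ n)

-- The colouring defined by the ordering

injective⇒surjective : ∀ {m} (f : Fin m → Fin m) → Injective _≡_ _≡_ f → ∀ v → ∃[ i ] f i ≡ v
injective⇒surjective {zero} f f-inj ()
injective⇒surjective {suc m} f f-inj v with any? (λ i → f i ≟ᶠ v)
... | yes hit = hit
... | no miss = ⊥-elim (1+n≰n (injective⇒≤ {f = squeeze} squeeze-injective))
  where
  squeeze : Fin (suc m) → Fin m
  squeeze i = punchOut {i = v} {j = f i} (λ v≡fi → miss (i , sym v≡fi))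
  squeeze-injective : Injective _≡_ _≡_ squeeze
  squeeze-injective {i} {j} eq =
    f-inj (punchOut-injective (λ v≡fi → miss (i , sym v≡fi)) (λ v≡fj → miss (j , sym v≡fj)) eq)

sum-tabulate≡∑ : ∀ {m} (F : Fin m → ℕ) → sum (tabulate F) ≡ ∑ F
sum-tabulate≡∑ {zero} F = refl
sum-tabulate≡∑ {suc m} F = cong (_+_ (F zero)) (sum-tabulate≡∑ (F ∘ suc))

sum≡∑ : ∀ {m} (F : Fin m → ℕ) → sum (map F (allFin m)) ≡ ∑ F
sum≡∑ F = trans (cong sum (map-tabulate (λ i → i) F)) (sum-tabulate≡∑ F)

∑-permute-injective : ∀ {m} (f : Fin m → Fin m) → Injective _≡_ _≡_ f → (F : Fin m → ℕ) → ∑ F ≡ ∑ (F ∘ f)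
∑-permute-injective {m} f f-inj F = sum-permute F π
  where
  preimage : ∀ v → ∃[ i ] f i ≡ v
  preimage = injective⇒surjective f f-inj
  π : Permutation m m
  π = permutation f (proj₁ ∘ preimage) (proj₂ ∘ preimage) (λ i → f-inj (proj₂ (preimage (f i))))

sumBelow : (ℕ → ℕ) → ℕ → ℕ
sumBelow F zero = 0
sumBelow F (suc m) = sumBelow F m + F m

sumBelow≡∑ : ∀ F m → sumBelow F m ≡ ∑ {m} (F ∘ toℕ)
sumBelow≡∑ F zero = refl
sumBelow≡∑ F (suc m) = begin
  sumBelow F m + F m
    ≡⟨ cong (_+ F m) (sumBelow≡∑ F m) ⟩
  ∑ {m} (F ∘ toℕ) + F m
    ≡⟨ cong₂ _+_ (sum-cong-≗ {m} {F ∘ toℕ} {F ∘ toℕ ∘ inject₁} (cong F ∘ sym ∘ toℕ-inject₁)) (cong F (sym (toℕ-fromℕ m))) ⟩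
  ∑ {m} (F ∘ toℕ ∘ inject₁) + F (toℕ (fromℕ m))
    ≡⟨ sum-init-last (F ∘ toℕ) ⟨
  ∑ {suc m} (F ∘ toℕ)
    ∎
  where open ≡-Reasoning

half≤pred : ∀ {d n} → 2 * d ≤ n → d ≤ n ∸ 1
half≤pred {zero} _ = z≤n
half≤pred {suc d} 2d≤n = m+n≤o⇒m≤o∸n (suc d) (≤-trans (+-monoʳ-≤ (suc d) (s≤s z≤n)) 2d≤n)

two-short-steps : ∀ {a b N} → a ≤ N → b ≤ N → 2 * a ≤ suc N → 2 * b ≤ suc N → N ≤ 1 + ((N ∸ a) + (N ∸ b))
two-short-steps {a} {b} {N} a≤N b≤N 2a≤ 2b≤ = +-cancelˡ-≤ N N _ (begin
  N + N                          ≡⟨ cong₂ _+_ (m+[n∸m]≡n a≤N) (m+[n∸m]≡n b≤N) ⟨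
  (a + (N ∸ a)) + (b + (N ∸ b))  ≡⟨ interchange a (N ∸ a) b (N ∸ b) ⟩
  (a + b) + ((N ∸ a) + (N ∸ b))  ≤⟨ +-monoˡ-≤ _ a+b≤ ⟩
  suc N + ((N ∸ a) + (N ∸ b))    ≡⟨ +-suc N _ ⟨
  N + (1 + ((N ∸ a) + (N ∸ b)))  ∎)
  where
  open ≤-Reasoning
  a+b≤ : a + b ≤ suc N
  a+b≤ = *-cancelˡ-≤ 2 (begin
    2 * (a + b)    ≡⟨ *-distribˡ-+ 2 a b ⟩
    2 * a + 2 * b  ≤⟨ +-mono-≤ 2a≤ 2b≤ ⟩
    suc N + suc N  ≡⟨ cong (_+_ (suc N)) (+-identityʳ (suc N)) ⟨
    2 * suc N      ∎)

module _ {n : ℕ} (x : Fin n → Fin n) where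

  open Ordering x

  Consecutive : (Fin n → Fin n → Set) → Set
  Consecutive R = ∀ i (p : suc i < n) → R (at i (pred< p)) (at (suc i) p)

module OrderColouring {n : ℕ} (D : Fin n → Fin n → ℕ) (L : Fin n → ℕ) (ζ ζ′ : ℕ)
                      (D-sym : ∀ u v → D u v ≡ D v u) (D-pos : ∀ u v → u ≢ v → 1 ≤ D u v)
                      (x : Fin n → Fin n) (x-injective : Injective _≡_ _≡_ x) (1≤n : 1 ≤ n)
                      (D≡L+L+ζ : Consecutive x λ a b → D a b ≡ L a + L b + ζ)
                      (2D≤n : Consecutive x λ a b → 2 * D a b ≤ n)
                      (ends : ∀ (p : 0 < n) (q : n ∸ 1 < n) → L (Ordering.at x 0 p) + L (Ordering.at x (n ∸ 1) q) ≡ ζ′)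
                      where

  open Ordering x
  open Colorings D

  N : ℕ
  N = n ∸ 1

  suc-N : suc N ≡ n
  suc-N = trans (+-comm 1 N) (m∸n+n≡m 1≤n)

  N<n : N < n
  N<n = subst (N <_) suc-N (n<1+n N)

  -- x_i, continued arbitrarily beyond i = n - 1 so that indices need not carry bounds.
  X : ℕ → Fin n
  X i with i <? n
  ... | yes i<n = x (fromℕ< i<n)
  ... | no _ = x (fromℕ< 1≤n)

  at≡X : ∀ i (p : i < n) → at i p ≡ X i
  at≡X i p with i <? n
  ... | yes i<n = cong x (fromℕ<-cong i i refl p i<n)
  ... | no i≮n = ⊥-elim (i≮n p)

  X-toℕ : ∀ j → X (toℕ j) ≡ x j
  X-toℕ j = trans (sym (at≡X (toℕ j) (toℕ<n j))) (cong x (fromℕ<-toℕ j (toℕ<n j)))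

  X-injective : ∀ {i j} → i < n → j < n → X i ≡ X j → i ≡ j
  X-injective {i} {j} i<n j<n eq = begin
    i                 ≡⟨ toℕ-fromℕ< i<n ⟨
    toℕ (fromℕ< i<n)  ≡⟨ cong toℕ (x-injective (trans (at≡X i i<n) (trans eq (sym (at≡X j j<n))))) ⟩
    toℕ (fromℕ< j<n)  ≡⟨ toℕ-fromℕ< j<n ⟩
    j                 ∎
    where open ≡-Reasoning

  consecutive : ∀ {R} → Consecutive x R → ∀ i → suc i < n → R (X i) (X (suc i))
  consecutive {R} holds i p = subst₂ R (at≡X i (pred< p)) (at≡X (suc i) p) (holds i p)

  D-step : ∀ i → suc i < n → D (X i) (X (suc i)) ≡ L (X i) + L (X (suc i)) + ζ
  D-step = consecutive {λ a b → D a b ≡ L a + L b + ζ} D≡L+L+ζ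

  2D-step≤n : ∀ i → suc i < n → 2 * D (X i) (X (suc i)) ≤ n
  2D-step≤n = consecutive {λ a b → 2 * D a b ≤ n} 2D≤n

  index : Fin n → Fin n
  index v = proj₁ (injective⇒surjective x x-injective v)

  X-index : ∀ v → X (toℕ (index v)) ≡ v
  X-index v = trans (X-toℕ (index v)) (proj₂ (injective⇒surjective x x-injective v))

  gap : ℕ → ℕ
  gap i = N ∸ D (X i) (X (suc i))

  g : ℕ → ℕ
  g zero = 0
  g (suc i) = g i + gap i

  h : Fin n → ℕ
  h v = g (toℕ (index v))

  h-X : ∀ i → i < n → h (X i) ≡ g i
  h-X i i<n = cong g (X-injective (toℕ<n (index (X i))) i<n (X-index (X i)))

  h-at : ∀ i (p : i < n) → h (at i p) ≡ g i
  h-at i p = trans (cong h (at≡X i p)) (h-X i p)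

  D≤N : ∀ i → suc i < n → D (X i) (X (suc i)) ≤ N
  D≤N i p = half≤pred (2D-step≤n i p)

  N≡gap+ζ+L+L : ∀ i → suc i < n → N ≡ gap i + ζ + L (X i) + L (X (suc i))
  N≡gap+ζ+L+L i p = begin
    N                                        ≡⟨ m∸n+n≡m (D≤N i p) ⟨
    gap i + D (X i) (X (suc i))              ≡⟨ cong (_+_ (gap i)) (D-step i p) ⟩
    gap i + (L (X i) + L (X (suc i)) + ζ)    ≡⟨ rearrange (gap i) (L (X i)) (L (X (suc i))) ζ ⟩
    gap i + ζ + L (X i) + L (X (suc i))      ∎
    where
    open ≡-Reasoning
    rearrange : ∀ g a b z → g + (a + b + z) ≡ g + z + a + b
    rearrange = solve-∀

  g-mono : ∀ {i j} → i ≤ j → g i ≤ g j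
  g-mono {i} {j} i≤j = subst (λ t → g i ≤ g t) (m∸n+n≡m i≤j) (g-shift (j ∸ i))
    where
    g-shift : ∀ k → g i ≤ g (k + i)
    g-shift zero = ≤-refl
    g-shift (suc k) = ≤-trans (g-shift k) (m≤m+n (g (k + i)) _)

  h≤g-N : ∀ v → h v ≤ g N
  h≤g-N v = g-mono (m+n≤o⇒m≤o∸n (toℕ (index v)) (subst (_≤ n) (+-comm 1 _) (toℕ<n (index v))))

  span-h : span h ≡ g N
  span-h = ≤-antisym (span≤ D h h≤g-N)
    (subst (_≤ span h) (trans (cong₂ ∣_-_∣ (h-X N N<n) (h-X 0 1≤n)) (∣-∣-identityʳ (g N))) (∣-∣≤span D h (X N) (X 0)))

  -- Consecutive colours differ by exactly the gap N ∸ D; for j ≥ i + 2 the two gaps after x_i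
  -- already suffice, because condition (c) keeps both steps at most n/2 long.
  hamiltonian-ordered : ∀ {i j} → i < j → j < n → N ≤ D (X i) (X j) + (g j ∸ g i)
  hamiltonian-ordered {i} {j} i<j j<n with m≤n⇒m<n∨m≡n i<j
  ... | inj₂ refl = ≤-reflexive (begin-equality
    N                                   ≡⟨ m∸n+n≡m (D≤N i j<n) ⟨
    gap i + D (X i) (X j)               ≡⟨ +-comm (gap i) _ ⟩
    D (X i) (X j) + gap i               ≡⟨ cong (_+_ (D (X i) (X j))) (m+n∸m≡n (g i) (gap i)) ⟨
    D (X i) (X j) + (g j ∸ g i)         ∎)
    where open ≤-Reasoning
  ... | inj₁ 1+i<j = begin
    N                                   ≤⟨ two-short-steps (D≤N i 1+i<n) (D≤N (suc i) 2+i<n)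
                                                           (2D≤ i 1+i<n) (2D≤ (suc i) 2+i<n) ⟩
    1 + (gap i + gap (suc i))           ≤⟨ +-mono-≤ (D-pos (X i) (X j) Xi≢Xj) two-gaps≤ ⟩
    D (X i) (X j) + (g j ∸ g i)         ∎
    where
    open ≤-Reasoning
    2+i<n : suc (suc i) < n
    2+i<n = ≤-<-trans 1+i<j j<n
    1+i<n : suc i < n
    1+i<n = <-trans (n<1+n (suc i)) 2+i<n
    2D≤ : ∀ k (p : suc k < n) → 2 * D (X k) (X (suc k)) ≤ suc N
    2D≤ k p = subst (2 * D (X k) (X (suc k)) ≤_) (sym suc-N) (2D-step≤n k p)
    Xi≢Xj : X i ≢ X j
    Xi≢Xj eq = <⇒≢ i<j (X-injective (<-trans (n<1+n i) 1+i<n) j<n eq)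
    two-gaps≤ : gap i + gap (suc i) ≤ g j ∸ g i
    two-gaps≤ = m+n≤o⇒m≤o∸n (gap i + gap (suc i))
      (subst (_≤ g j) (trans (+-assoc (g i) (gap i) (gap (suc i))) (+-comm (g i) _)) (g-mono 1+i<j))

  hamiltonian-indices : ∀ {i j} → i < j → j < n → N ≤ D (X i) (X j) + ∣ g i - g j ∣
  hamiltonian-indices {i} {j} i<j j<n = subst (λ t → N ≤ D (X i) (X j) + t)
    (sym (trans (∣-∣-comm (g i) (g j)) (m≤n⇒∣n-m∣≡n∸m (g-mono (<⇒≤ i<j)))))
    (hamiltonian-ordered i<j j<n)

  h-hamiltonian : IsHamiltonianColoring h
  h-hamiltonian u v u≢v with <-cmp (toℕ (index u)) (toℕ (index v))
  ... | tri< i<j _ _ = subst₂ (λ a b → N ≤ D a b + ∣ h u - h v ∣) (X-index u) (X-index v)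
                         (hamiltonian-indices i<j (toℕ<n (index v)))
  ... | tri≈ _ i≡j _ = ⊥-elim (u≢v (trans (sym (X-index u)) (trans (cong X i≡j) (X-index v))))
  ... | tri> _ _ j<i = subst₂ (λ a b → N ≤ D a b + ∣ h u - h v ∣) (X-index u) (X-index v)
                         (subst₂ (λ d t → N ≤ d + t) (D-sym _ _) (∣-∣-comm (h v) (h u))
                           (hamiltonian-indices j<i (toℕ<n (index u))))

  hSeq≡g : ∀ i (p : i < n) → hSeq ζ L i p ≡ + g i
  hSeq≡g zero p = refl
  hSeq≡g (suc i) p rewrite hSeq≡g i (pred< p) | at≡X i (pred< p) | at≡X (suc i) p =
    trans (cong (ℤ._+_ (+ g i)) (+a-+c-+d-+e≡+b N (gap i) ζ (L (X i)) (L (X (suc i))) (N≡gap+ζ+L+L i p)))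
          (sym (ℤ.pos-+ (g i) (gap i)))

  ΣL-pairs : ℕ → ℕ
  ΣL-pairs = sumBelow (λ k → L (X k) + L (X (suc k)))

  telescope : ∀ m → m < n → g m + m * ζ + ΣL-pairs m ≡ m * N
  telescope zero _ = refl
  telescope (suc m) p = begin
    g m + gap m + (ζ + m * ζ) + (ΣL-pairs m + (L (X m) + L (X (suc m))))
      ≡⟨ rearrange (g m) (gap m) ζ (m * ζ) (ΣL-pairs m) (L (X m)) (L (X (suc m))) ⟩
    (g m + m * ζ + ΣL-pairs m) + (gap m + ζ + L (X m) + L (X (suc m)))
      ≡⟨ cong₂ _+_ (telescope m (<-trans (n<1+n m) p)) (sym (N≡gap+ζ+L+L m p)) ⟩
    m * N + N
      ≡⟨ +-comm (m * N) N ⟩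
    suc m * N ∎
    where
    open ≡-Reasoning
    rearrange : ∀ g d z mz P a b → g + d + (z + mz) + (P + (a + b)) ≡ (g + mz + P) + (d + z + a + b)
    rearrange = solve-∀

  pairs-twice : ∀ m → ΣL-pairs m + L (X 0) + L (X m) ≡ sumBelow (L ∘ X) (suc m) + sumBelow (L ∘ X) (suc m)
  pairs-twice zero = refl
  pairs-twice (suc m) = begin
    ΣL-pairs m + (L (X m) + L (X (suc m))) + L (X 0) + L (X (suc m))
      ≡⟨ rearrange (ΣL-pairs m) (L (X 0)) (L (X m)) (L (X (suc m))) ⟩
    ΣL-pairs m + L (X 0) + L (X m) + L (X (suc m)) + L (X (suc m))
      ≡⟨ cong (λ t → t + L (X (suc m)) + L (X (suc m))) (pairs-twice m) ⟩
    S + S + L (X (suc m)) + L (X (suc m))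
      ≡⟨ rearrange′ S (L (X (suc m))) ⟩
    (S + L (X (suc m))) + (S + L (X (suc m))) ∎
    where
    open ≡-Reasoning
    S : ℕ
    S = sumBelow (L ∘ X) (suc m)
    rearrange : ∀ P a b c → P + (b + c) + a + c ≡ P + a + b + c + c
    rearrange = solve-∀
    rearrange′ : ∀ s c → s + s + c + c ≡ (s + c) + (s + c)
    rearrange′ = solve-∀

  sumBelow-ordering : sumBelow (L ∘ X) n ≡ sum (map L (allFin n))
  sumBelow-ordering = begin
    sumBelow (L ∘ X) n       ≡⟨ sumBelow≡∑ (L ∘ X) n ⟩
    ∑ {n} (L ∘ X ∘ toℕ)      ≡⟨ sum-cong-≗ {n} {L ∘ X ∘ toℕ} {L ∘ x} (cong L ∘ X-toℕ) ⟩
    ∑ {n} (L ∘ x)            ≡⟨ ∑-permute-injective x x-injective L ⟨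
    ∑ {n} L                  ≡⟨ sum≡∑ L ⟨
    sum (map L (allFin n))   ∎
    where open ≡-Reasoning

  span-identity : N * N + ζ′ ≡ span h + (N * ζ + (sum (map L (allFin n)) + sum (map L (allFin n))))
  span-identity = begin
    N * N + ζ′                                       ≡⟨ cong₂ _+_ (telescope N N<n) ends-X ⟨
    (g N + N * ζ + ΣL-pairs N) + (L (X 0) + L (X N)) ≡⟨ rearrange (g N) (N * ζ) (ΣL-pairs N) (L (X 0)) (L (X N)) ⟩
    g N + (N * ζ + (ΣL-pairs N + L (X 0) + L (X N))) ≡⟨ cong (λ t → g N + (N * ζ + t)) (pairs-twice N) ⟩
    g N + (N * ζ + (S + S))                          ≡⟨ cong₂ (λ s t → s + (N * ζ + (t + t))) (sym span-h) ΣL≡ ⟩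
    span h + (N * ζ + (ΣL + ΣL))                     ∎
    where
    open ≡-Reasoning
    ΣL S : ℕ
    ΣL = sum (map L (allFin n))
    S = sumBelow (L ∘ X) (suc N)
    ΣL≡ : S ≡ ΣL
    ΣL≡ = trans (cong (sumBelow (L ∘ X)) suc-N) sumBelow-ordering
    ends-X : L (X 0) + L (X N) ≡ ζ′
    ends-X = subst₂ (λ a b → L a + L b ≡ ζ′) (at≡X 0 1≤n) (at≡X N N<n) (ends 1≤n N<n)
    rearrange : ∀ g c p a b → (g + c + p) + (a + b) ≡ g + (c + (p + a + b))
    rearrange = solve-∀

theorem3 : ∀ {n : ℕ} (T : SimpleGraph n) (D : Fin n → Fin n → ℕ) →
  IsTree T → 4 ≤ n → MaxDegreeAtLeast3 T → IsDetourDistance T D →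
  (x : Fin n → Fin n) → Injective _≡_ _≡_ x →
  (∀ (p : 0 < n) (q : n ∸ 1 < n) →
        (∀ w → Weights.centers D ≡ w ∷ [] →
           Weights.𝓛 D (Ordering.at x 0 p) + Weights.𝓛 D (Ordering.at x (n ∸ 1) q) ≡ 1)
      × (∀ w w′ → Weights.centers D ≡ w ∷ w′ ∷ [] →
           Weights.𝓛 D (Ordering.at x 0 p) + Weights.𝓛 D (Ordering.at x (n ∸ 1) q) ≡ 0)) →
  (∀ (i : ℕ) (p : suc i < n) →
       (∀ w → Weights.centers D ≡ w ∷ [] →
          OnPath T w (Ordering.at x i (Ordering.pred< x p)) (Ordering.at x (suc i) p))
     × (∀ w w′ → Weights.centers D ≡ w ∷ w′ ∷ [] →
          EdgeOnPath T w w′ (Ordering.at x i (Ordering.pred< x p)) (Ordering.at x (suc i) p))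
     × (2 * D (Ordering.at x i (Ordering.pred< x p)) (Ordering.at x (suc i) p) ≤ n)) →
  Colorings.HcEquals D
    (((+ (n ∸ 1)) ℤ.* (+ (n ∸ 1) ℤ.- + Weights.ζ D) ℤ.+ + Weights.ζ′ D)
       ℤ.- (+ 2) ℤ.* (+ Weights.𝓛W D))
  × (Σ (Fin n → ℕ) λ h →
       (∀ (i : ℕ) (p : i < n) →
          + h (Ordering.at x i p) ≡ Ordering.hSeq x (Weights.ζ D) (Weights.𝓛 D) i p)
       × Colorings.IsOptimalHamiltonianColoring D h)
theorem3 {n} T D (_ , acyclic) 4≤n _ isD x x-injective ends-condition step-condition =
  subst HcEquals (sym (hc-formula N ζ ζ′ 𝓛W)) (proj₁ bounds) , h , hSeq≡h , proj₂ bounds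
  where
  open Weights D
  open TreeDistance acyclic isD
  open CentreBounds acyclic isD
  open Colorings D
  open OrderColouring D 𝓛 ζ ζ′ D-sym D-pos x x-injective (≤-trans (s≤s z≤n) 4≤n)
    (λ i p → D≡𝓛+𝓛+ζ (proj₁ (step-condition i p)) (proj₁ (proj₂ (step-condition i p))))
    (λ i p → proj₂ (proj₂ (step-condition i p)))
    (λ p q → 𝓛+𝓛≡ζ′ (proj₁ (ends-condition p q)) (proj₂ (ends-condition p q)))
  open LowerBound D 𝓛 ζ ζ′ D≤𝓛+𝓛+ζ ζ′≤𝓛+𝓛

  bounds : HcEquals (+ (N * N + ζ′) ℤ.- + (N * ζ + (𝓛W + 𝓛W))) × IsOptimalHamiltonianColoring h
  bounds = hc-from-bounds D {h} h-hamiltonian span-identity (span-lower-bound (≤-trans (s≤s (s≤s z≤n)) 4≤n))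

  hSeq≡h : ∀ i (p : i < n) → + h (Ordering.at x i p) ≡ Ordering.hSeq x ζ 𝓛 i p
  hSeq≡h i p = trans (cong +_ (h-at i p)) (sym (hSeq≡g i p))
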